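{- For all nonnegative integers $k$, $n$, $r$, \[\sum_{i=0}^k\binom{(r+1)i+n}{i}=\sum_{\alpha\in\mathcal{C}(k,r)}(-1)^{|\alpha|-\ell(\alpha)}\Biggl(\prod_{j=1}^{\ell(\alpha)}\binom{r}{\alpha_j-1}\Biggr)\binom{(r+1)k+n+1-|\alpha|+\ell(\alpha)}{k-|\alpha|}.\]
   Context: A composition $\alpha=(\alpha_1,\dots,\alpha_{\ell(\alpha)})$ is a finite (possibly empty) sequence of positive integers; $|\alpha|$ is the sum of its parts and $\ell(\alpha)$ the number of parts. $\mathcal{C}(k,r)$ is the set of all compositions $\alpha$ with $|\alpha|\le k$ and $2\le\alpha_i\le r+1$ for every part $\alpha_i$ (the empty composition is included; an empty product equals $1$). -}

module Defs where

open import Data.Nat using (ℕ; zero; suc; _+_; _∸_; _≤_; _≤?_)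
open import Data.Nat.Combinatorics using (_C_)
open import Data.Integer using (ℤ; +_; -_; _*_)
open import Data.List using (List; []; _∷_; map; concatMap; filter; upTo; length)
open import Data.Nat.ListAction using (sum; product)
open import Data.List.Relation.Unary.All using (All; all?)
open import Data.Product using (_×_)
open import Relation.Nullary.Decidable using (_×-dec_)

-- We generate all lists of
-- positive naturals summing to m:
--   compositions of (suc m) are  1 ∷ c  for c a composition of m,
--   or c with its first part incremented, for c a nonempty composition of m.
Composition : Set
Composition = List ℕ

bumpHead : Composition → List Composition
bumpHead []      = []
bumpHead (a ∷ c) = (suc a ∷ c) ∷ []

compositionsOf : ℕ → List Composition
compositionsOf zero    = [] ∷ []
compositionsOf (suc m) = map (1 ∷_) (compositionsOf m) Data.List.++ concatMap bumpHead (compositionsOf m)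

∣_∣ᶜ : Composition → ℕ
∣ α ∣ᶜ = sum α

ℓ : Composition → ℕ
ℓ = length

C-set : ℕ → ℕ → List Composition
C-set k r = filter (λ α → all? (λ a → (2 ≤? a) ×-dec (a ≤? suc r)) α)
                   (concatMap compositionsOf (upTo (suc k)))

sgn : ℕ → ℤ
sgn zero          = + 1
sgn (suc zero)    = - (+ 1)
sgn (suc (suc e)) = sgn e

Σ≤ : ℕ → (ℕ → ℕ) → ℕ
Σ≤ k f = sum (map f (upTo (suc k)))

rhsTerm : ℕ → ℕ → ℕ → Composition → ℤ
rhsTerm k n r α =
  sgn (∣ α ∣ᶜ ∸ ℓ α)
  * + (product (map (λ a → r C (a ∸ 1)) α)
       Data.Nat.* (((suc r) Data.Nat.* k + n + 1 ∸ ∣ α ∣ᶜ + ℓ α) C (k ∸ ∣ α ∣ᶜ)))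

sumℤ : List ℤ → ℤ
sumℤ []       = + 0
sumℤ (x ∷ xs) = x Data.Integer.+ sumℤ xs

{-# OPTIONS --safe #-}
-- Let S(n,K) and R(n,K) be the two sides of the identity for k = K.  Both F = S and F = R satisfy
-- F(n,0) = 1 and
--   F(n,K+1) = C((r+1)(K+1)+n+1, K+1) + Σ_{a=1}^{K} (-1)^a C(r,a) F(n+r+1+ra, K-a),
-- so they agree by strong induction on K.  For R this is the decomposition of 𝒞(K+1,r) by the first
-- part a+1 of α: the remaining parts form some β ∈ 𝒞(K-a,r), and the binomial attached to α is the
-- one attached to β with n replaced by n+r+1+ra.  For S, Pascal's rule gives
-- S(n,K+1) + S(n+r+1,K) = S(n+1,K+1), and summing the identity
--   Σ_{j≤b} (-1)^j C(r,j) C(A+r-j, b-j) = C(A,b)        (induction on r)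
-- along the diagonals of the double sum gives Σ_{j≤K} (-1)^j C(r,j) S(n+r+1+rj, K-j) = S(n+1,K);
-- eliminating S(n+1,·) between these two relations yields the recursion.
module Submission where

open import Defs
open import Data.Nat using (ℕ; zero; suc; _+_; _*_; _∸_; _≤_; _<_; s≤s; z≤n; _≤?_)
import Data.Nat.Properties as ℕ
open import Data.Nat.Combinatorics using (_C_; nCk+nC[k+1]≡[n+1]C[k+1]; k>n⇒nCk≡0)
open import Data.Nat.Induction using (<-rec)
open import Data.Nat.ListAction using (sum; product)
open import Data.Integer using (ℤ; +_; -_) renaming (_+_ to _+ℤ_; _*_ to _*ℤ_)
import Data.Integer.Properties as ℤ
import Data.Integer.Tactic.RingSolver as ℤ-Solver
import Data.Nat.Tactic.RingSolver as NatSolver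
import Algebra.Properties.CommutativeSemigroup as CommSemigroupProperties
open import Data.Bool using (true; false; if_then_else_)
open import Data.List using (List; []; _∷_; _++_; map; applyUpTo; concatMap; filter; upTo)
import Data.List.Properties as Lₚ
open import Data.List.Relation.Unary.All as All using (All; []; _∷_; all?)
open import Data.List.Relation.Unary.All.Properties using (++⁺; map⁺; concat⁺)
open import Data.Product using (_×_; _,_)
open import Function using (_∘_)
open import Relation.Nullary using (Dec; yes; no; does; ¬_)
open import Relation.Nullary.Decidable using (_×-dec_; dec-true; dec-false)
open import Relation.Binary.PropositionalEquality
  using (_≡_; refl; sym; trans; cong; cong₂; module ≡-Reasoning)

open import Algebra.Properties.AbelianGroup ℤ.+-0-abelianGroup
  using () renaming (∙-cancelʳ to +ℤ-cancelʳ; //-rightDividesʳ to +ℤ-cancel-neg)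
open CommSemigroupProperties ℤ.+-commutativeSemigroup using () renaming (interchange to +ℤ-interchange)
open CommSemigroupProperties ℤ.*-commutativeSemigroup using () renaming (interchange to *ℤ-interchange)

sgn-suc : ∀ e → sgn (suc e) ≡ - sgn e
sgn-suc zero    = refl
sgn-suc (suc e) = sym (trans (cong -_ (sgn-suc e)) (ℤ.neg-involutive (sgn e)))

sgn-+ : ∀ d e → sgn (d + e) ≡ sgn d *ℤ sgn e
sgn-+ zero    e = sym (ℤ.*-identityˡ (sgn e))
sgn-+ (suc d) e = begin
  sgn (suc (d + e))      ≡⟨ sgn-suc (d + e) ⟩
  - sgn (d + e)          ≡⟨ cong -_ (sgn-+ d e) ⟩
  - (sgn d *ℤ sgn e)     ≡⟨ ℤ.neg-distribˡ-* (sgn d) (sgn e) ⟩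
  - sgn d *ℤ sgn e       ≡⟨ cong (_*ℤ sgn e) (sym (sgn-suc d)) ⟩
  sgn (suc d) *ℤ sgn e   ∎
  where open ≡-Reasoning

∑< : ℕ → (ℕ → ℤ) → ℤ
∑< zero    f = + 0
∑< (suc k) f = f 0 +ℤ ∑< k (f ∘ suc)

infixr 8 ∑<
syntax ∑< k (λ i → e) = ∑[ i < k ] e

∑-cong : ∀ k {f g : ℕ → ℤ} → (∀ {i} → i < k → f i ≡ g i) → ∑< k f ≡ ∑< k g
∑-cong zero    f≗g = refl
∑-cong (suc k) f≗g = cong₂ _+ℤ_ (f≗g (s≤s z≤n)) (∑-cong k (f≗g ∘ s≤s))

∑-zero : ∀ k → ∑[ i < k ] + 0 ≡ + 0
∑-zero zero    = refl
∑-zero (suc k) = trans (ℤ.+-identityˡ _) (∑-zero k)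

∑-init-last : ∀ k (f : ℕ → ℤ) → ∑< (suc k) f ≡ ∑< k f +ℤ f k
∑-init-last zero    f = ℤ.+-comm (f 0) (+ 0)
∑-init-last (suc k) f = trans (cong (f 0 +ℤ_) (∑-init-last k (f ∘ suc))) (sym (ℤ.+-assoc (f 0) _ _))

∑-distrib-+ : ∀ k (f g : ℕ → ℤ) → ∑[ i < k ] (f i +ℤ g i) ≡ ∑< k f +ℤ ∑< k g
∑-distrib-+ zero    f g = refl
∑-distrib-+ (suc k) f g = trans (cong ((f 0 +ℤ g 0) +ℤ_) (∑-distrib-+ k (f ∘ suc) (g ∘ suc)))
                                (+ℤ-interchange (f 0) (g 0) _ _)

∑-distribˡ-* : ∀ k c (f : ℕ → ℤ) → ∑[ i < k ] (c *ℤ f i) ≡ c *ℤ ∑< k f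
∑-distribˡ-* zero    c f = sym (ℤ.*-zeroʳ c)
∑-distribˡ-* (suc k) c f = trans (cong (c *ℤ f 0 +ℤ_) (∑-distribˡ-* k c (f ∘ suc)))
                                 (sym (ℤ.*-distribˡ-+ c (f 0) _))

∑-neg : ∀ k (f : ℕ → ℤ) → ∑[ i < k ] (- f i) ≡ - ∑< k f
∑-neg zero    f = refl
∑-neg (suc k) f = trans (cong (- f 0 +ℤ_) (∑-neg k (f ∘ suc))) (sym (ℤ.neg-distrib-+ (f 0) _))

∑-triangle : ∀ K (F : ℕ → ℕ → ℤ) →
  ∑[ m < suc K ] ∑[ a < suc m ] F a (m ∸ a) ≡ ∑[ a < suc K ] ∑[ i < suc (K ∸ a) ] F a i
∑-triangle zero    F = refl
∑-triangle (suc K) F = begin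
  (F 0 0 +ℤ + 0) +ℤ ∑[ m < suc K ] (F 0 (suc m) +ℤ ∑[ a < suc m ] F (suc a) (m ∸ a))
    ≡⟨ cong₂ _+ℤ_ (ℤ.+-identityʳ (F 0 0)) (∑-distrib-+ (suc K) (F 0 ∘ suc) (λ m → ∑[ a < suc m ] F (suc a) (m ∸ a))) ⟩
  F 0 0 +ℤ (∑[ m < suc K ] F 0 (suc m) +ℤ ∑[ m < suc K ] ∑[ a < suc m ] F (suc a) (m ∸ a))
    ≡⟨ sym (ℤ.+-assoc (F 0 0) _ _) ⟩
  ∑[ i < suc (suc K) ] F 0 i +ℤ ∑[ m < suc K ] ∑[ a < suc m ] F (suc a) (m ∸ a)
    ≡⟨ cong (∑[ i < suc (suc K) ] F 0 i +ℤ_) (∑-triangle K (F ∘ suc)) ⟩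
  ∑[ i < suc (suc K) ] F 0 i +ℤ ∑[ a < suc K ] ∑[ i < suc (K ∸ a) ] F (suc a) i ∎
  where open ≡-Reasoning

variable
  A B : Set

sumℤ-++ : ∀ (f : A → ℤ) xs ys → sumℤ (map f (xs ++ ys)) ≡ sumℤ (map f xs) +ℤ sumℤ (map f ys)
sumℤ-++ f []       ys = sym (ℤ.+-identityˡ _)
sumℤ-++ f (x ∷ xs) ys = trans (cong (f x +ℤ_) (sumℤ-++ f xs ys)) (sym (ℤ.+-assoc (f x) _ _))

sumℤ-concatMap : ∀ (f : B → ℤ) (h : A → List B) xs →
  sumℤ (map f (concatMap h xs)) ≡ sumℤ (map (λ x → sumℤ (map f (h x))) xs)
sumℤ-concatMap f h []       = refl
sumℤ-concatMap f h (x ∷ xs) =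
  trans (sumℤ-++ f (h x) (concatMap h xs)) (cong (sumℤ (map f (h x)) +ℤ_) (sumℤ-concatMap f h xs))

sumℤ-cong : ∀ {f g : A → ℤ} {xs} → All (λ x → f x ≡ g x) xs → sumℤ (map f xs) ≡ sumℤ (map g xs)
sumℤ-cong []           = refl
sumℤ-cong (fx≡gx ∷ eq) = cong₂ _+ℤ_ fx≡gx (sumℤ-cong eq)

sumℤ-distribˡ-* : ∀ c (f : A → ℤ) xs → sumℤ (map (λ x → c *ℤ f x) xs) ≡ c *ℤ sumℤ (map f xs)
sumℤ-distribˡ-* c f []       = sym (ℤ.*-zeroʳ c)
sumℤ-distribˡ-* c f (x ∷ xs) =
  trans (cong (c *ℤ f x +ℤ_) (sumℤ-distribˡ-* c f xs)) (sym (ℤ.*-distribˡ-+ c (f x) _))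

sumℤ-map-applyUpTo : ∀ (f : A → ℤ) (g : ℕ → A) k →
  sumℤ (map f (applyUpTo g k)) ≡ ∑[ i < k ] f (g i)
sumℤ-map-applyUpTo f g zero    = refl
sumℤ-map-applyUpTo f g (suc k) = cong (f (g 0) +ℤ_) (sumℤ-map-applyUpTo f (g ∘ suc) k)

sumℤ-filter : ∀ {P : A → Set} (P? : ∀ x → Dec (P x)) (f : A → ℤ) xs →
  sumℤ (map f (filter P? xs)) ≡ sumℤ (map (λ x → if does (P? x) then f x else + 0) xs)
sumℤ-filter P? f []       = refl
sumℤ-filter P? f (x ∷ xs) with does (P? x)
... | true  = cong (f x +ℤ_) (sumℤ-filter P? f xs)
... | false = trans (sumℤ-filter P? f xs) (sym (ℤ.+-identityˡ _))

pos-sum-map : ∀ (f : A → ℕ) xs → + sum (map f xs) ≡ sumℤ (map (+_ ∘ f) xs)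
pos-sum-map f []       = refl
pos-sum-map f (x ∷ xs) = trans (ℤ.pos-+ (f x) _) (cong (+ f x +ℤ_) (pos-sum-map f xs))

∑ᶜ : ℕ → (Composition → ℤ) → ℤ
∑ᶜ m g = sumℤ (map g (compositionsOf m))

compositionsOf-sum : ∀ m → All (λ α → ∣ α ∣ᶜ ≡ m) (compositionsOf m)
compositionsOf-sum zero    = refl ∷ []
compositionsOf-sum (suc m) =
  ++⁺ (map⁺ (All.map (cong suc) IH)) (concat⁺ (map⁺ (All.map bumpHead-sum IH)))
  where
  IH : All (λ α → ∣ α ∣ᶜ ≡ m) (compositionsOf m)
  IH = compositionsOf-sum m
  bumpHead-sum : ∀ {α} → ∣ α ∣ᶜ ≡ m → All (λ β → ∣ β ∣ᶜ ≡ suc m) (bumpHead α)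
  bumpHead-sum {[]}    _   = []
  bumpHead-sum {_ ∷ _} ∣α∣≡m = cong suc ∣α∣≡m ∷ []

∑ᶜ-cong : ∀ m {g h : Composition → ℤ} → (∀ α → ∣ α ∣ᶜ ≡ m → g α ≡ h α) → ∑ᶜ m g ≡ ∑ᶜ m h
∑ᶜ-cong m g≗h = sumℤ-cong (All.map (g≗h _) (compositionsOf-sum m))

∑ᶜ-suc : ∀ m g → ∑ᶜ (suc m) g ≡ ∑ᶜ m (λ α → g (1 ∷ α)) +ℤ ∑ᶜ m (λ α → sumℤ (map g (bumpHead α)))
∑ᶜ-suc m g = trans (sumℤ-++ g (map (1 ∷_) cs) (concatMap bumpHead cs))
                   (cong₂ _+ℤ_ (cong sumℤ (sym (Lₚ.map-∘ cs))) (sumℤ-concatMap g bumpHead cs))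
  where
  cs : List Composition
  cs = compositionsOf m

∑ᶜ-by-first-part : ∀ m g → ∑ᶜ (suc m) g ≡ ∑[ a < suc m ] ∑ᶜ (m ∸ a) (λ β → g (suc a ∷ β))
∑ᶜ-by-first-part zero    g = ∑ᶜ-suc 0 g
∑ᶜ-by-first-part (suc m) g = trans (∑ᶜ-suc (suc m) g) (cong (∑ᶜ (suc m) (λ α → g (1 ∷ α)) +ℤ_) (begin
  ∑ᶜ (suc m) (λ α → sumℤ (map g (bumpHead α)))
    ≡⟨ ∑ᶜ-by-first-part m _ ⟩
  ∑[ a < suc m ] ∑ᶜ (m ∸ a) (λ β → g (suc (suc a) ∷ β) +ℤ + 0)
    ≡⟨ ∑-cong (suc m) (λ {a} _ → ∑ᶜ-cong (m ∸ a) (λ β _ → ℤ.+-identityʳ (g (suc (suc a) ∷ β)))) ⟩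
  ∑[ a < suc m ] ∑ᶜ (m ∸ a) (λ β → g (suc (suc a) ∷ β)) ∎))
  where open ≡-Reasoning

∑ᶜ≤ : ℕ → (Composition → ℤ) → ℤ
∑ᶜ≤ K g = ∑[ m < suc K ] ∑ᶜ m g

∑ᶜ≤-cong : ∀ K {g h : Composition → ℤ} → (∀ α → ∣ α ∣ᶜ ≤ K → g α ≡ h α) → ∑ᶜ≤ K g ≡ ∑ᶜ≤ K h
∑ᶜ≤-cong K g≗h = ∑-cong (suc K) (λ m<1+K → ∑ᶜ-cong _ (λ α ∣α∣≡m →
  g≗h α (ℕ.≤-trans (ℕ.≤-reflexive ∣α∣≡m) (ℕ.≤-pred m<1+K))))

∑ᶜ≤-distribˡ-* : ∀ K c g → ∑ᶜ≤ K (λ α → c *ℤ g α) ≡ c *ℤ ∑ᶜ≤ K g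
∑ᶜ≤-distribˡ-* K c g = trans (∑-cong (suc K) (λ {m} _ → sumℤ-distribˡ-* c g (compositionsOf m)))
                             (∑-distribˡ-* (suc K) c (λ m → ∑ᶜ m g))

∑ᶜ≤-suc : ∀ K g → ∑ᶜ≤ (suc K) g ≡ g [] +ℤ ∑[ a < suc K ] ∑ᶜ≤ (K ∸ a) (λ β → g (suc a ∷ β))
∑ᶜ≤-suc K g = cong₂ _+ℤ_ (ℤ.+-identityʳ (g []))
  (trans (∑-cong (suc K) (λ {m} _ → ∑ᶜ-by-first-part m g))
         (∑-triangle K (λ a i → ∑ᶜ i (λ β → g (suc a ∷ β)))))

m≡n+o⇒m∸n≡o : ∀ {m} n {o} → m ≡ n + o → m ∸ n ≡ o
m≡n+o⇒m∸n≡o n {o} m≡n+o = trans (cong (_∸ n) m≡n+o) (ℕ.m+n∸m≡n n o)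

signedBinom : ℕ → ℕ → ℤ
signedBinom r j = sgn j *ℤ + (r C j)

signedBinom-vanishes : ∀ {r j} → r < j → signedBinom r j ≡ + 0
signedBinom-vanishes {j = j} r<j =
  trans (cong (λ c → sgn j *ℤ + c) (k>n⇒nCk≡0 r<j)) (ℤ.*-zeroʳ (sgn j))

pascal : ∀ m k → suc m C suc k ≡ m C k + m C suc k
pascal m k = sym (nCk+nC[k+1]≡[n+1]C[k+1] m k)

signedBinom-convolution : ∀ r A b →
  ∑[ j < suc b ] (signedBinom r j *ℤ + ((A + r ∸ j) C (b ∸ j))) ≡ + (A C b)
signedBinom-convolution zero A b = begin
  + 1 *ℤ + ((A + 0) C b) +ℤ ∑[ j < b ] ((sgn (suc j) *ℤ + 0) *ℤ X j)
    ≡⟨ cong₂ _+ℤ_ (trans (ℤ.*-identityˡ _) (cong (λ m → + (m C b)) (ℕ.+-identityʳ A)))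
                  (trans (∑-cong b (λ {j} _ → cong (_*ℤ X j) (ℤ.*-zeroʳ (sgn (suc j))))) (∑-zero b)) ⟩
  + (A C b) +ℤ + 0
    ≡⟨ ℤ.+-identityʳ _ ⟩
  + (A C b) ∎
  where
  open ≡-Reasoning
  X : ℕ → ℤ
  X j = + ((A + 0 ∸ suc j) C (b ∸ suc j))
signedBinom-convolution (suc r) A zero    = refl
signedBinom-convolution (suc r) A (suc b) = begin
  f 0 +ℤ ∑[ j < suc b ] f (suc j)
    ≡⟨ cong₂ _+ℤ_ f0≡g0 (∑-cong (suc b) (λ {j} _ → f-suc j)) ⟩
  g 0 +ℤ ∑[ j < suc b ] (g (suc j) +ℤ - h j)
    ≡⟨ cong (g 0 +ℤ_) (trans (∑-distrib-+ (suc b) (g ∘ suc) (λ j → - h j))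
                             (cong (∑[ j < suc b ] g (suc j) +ℤ_) (∑-neg (suc b) h))) ⟩
  g 0 +ℤ (∑[ j < suc b ] g (suc j) +ℤ - ∑[ j < suc b ] h j)
    ≡⟨ sym (ℤ.+-assoc (g 0) _ _) ⟩
  ∑[ j < suc (suc b) ] g j +ℤ - ∑[ j < suc b ] h j
    ≡⟨ cong₂ (λ x y → x +ℤ - y) (signedBinom-convolution r (suc A) (suc b)) (signedBinom-convolution r A b) ⟩
  + (suc A C suc b) +ℤ - + (A C b)
    ≡⟨ cong (λ x → x +ℤ - + (A C b)) (trans (cong +_ (trans (pascal A b) (ℕ.+-comm (A C b) _)))
                                            (ℤ.pos-+ (A C suc b) (A C b))) ⟩
  + (A C suc b) +ℤ + (A C b) +ℤ - + (A C b)
    ≡⟨ +ℤ-cancel-neg (+ (A C b)) (+ (A C suc b)) ⟩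
  + (A C suc b) ∎
  where
  open ≡-Reasoning
  f g h : ℕ → ℤ
  f j = signedBinom (suc r) j *ℤ + ((A + suc r ∸ j) C (suc b ∸ j))
  g j = signedBinom r j *ℤ + ((suc A + r ∸ j) C (suc b ∸ j))
  h j = signedBinom r j *ℤ + ((A + r ∸ j) C (b ∸ j))
  f0≡g0 : f 0 ≡ g 0
  f0≡g0 = cong (λ m → + 1 *ℤ + (m C suc b)) (ℕ.+-suc A r)
  f-suc : ∀ j → f (suc j) ≡ g (suc j) +ℤ - h j
  f-suc j = begin
    sgn (suc j) *ℤ + (suc r C suc j) *ℤ + ((A + suc r ∸ suc j) C (b ∸ j))
      ≡⟨ cong₂ (λ c m → sgn (suc j) *ℤ c *ℤ + (m C (b ∸ j)))
               (trans (cong +_ (pascal r j)) (ℤ.pos-+ (r C j) _)) (cong (_∸ suc j) (ℕ.+-suc A r)) ⟩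
    sgn (suc j) *ℤ (+ (r C j) +ℤ + (r C suc j)) *ℤ Y
      ≡⟨ cong (λ s → s *ℤ (+ (r C j) +ℤ + (r C suc j)) *ℤ Y) (sgn-suc j) ⟩
    - sgn j *ℤ (+ (r C j) +ℤ + (r C suc j)) *ℤ Y
      ≡⟨ distrib (sgn j) (+ (r C j)) (+ (r C suc j)) Y ⟩
    - sgn j *ℤ + (r C suc j) *ℤ Y +ℤ - (sgn j *ℤ + (r C j) *ℤ Y)
      ≡⟨ cong (λ s → s *ℤ + (r C suc j) *ℤ Y +ℤ - h j) (sym (sgn-suc j)) ⟩
    g (suc j) +ℤ - h j ∎
    where
    Y : ℤ
    Y = + ((A + r ∸ j) C (b ∸ j))
    distrib : ∀ s p q y → - s *ℤ (p +ℤ q) *ℤ y ≡ - s *ℤ q *ℤ y +ℤ - (s *ℤ p *ℤ y)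
    distrib = ℤ-Solver.solve-∀

module _ (r : ℕ) where

  emptyTerm : ℕ → ℕ → ℤ
  emptyTerm n K = + ((suc r * K + suc n) C K)

  -- the weight of a first part of size a + 1; parts of size 1 do not occur in 𝒞(k,r)
  firstPartWeight : ℕ → ℤ
  firstPartWeight zero    = + 0
  firstPartWeight (suc j) = signedBinom r (suc j)

  record SolvesRecurrence (f : ℕ → ℕ → ℤ) : Set where
    field
      initial : ∀ n → f n 0 ≡ + 1
      step    : ∀ n K → f n (suc K) ≡
                emptyTerm n (suc K) +ℤ ∑[ a < suc K ] (firstPartWeight a *ℤ f (n + suc r + r * a) (K ∸ a))

  recurrence-unique : ∀ {f g} → SolvesRecurrence f → SolvesRecurrence g → ∀ K n → f n K ≡ g n K
  recurrence-unique {f} {g} F G = <-rec (λ K → ∀ n → f n K ≡ g n K) agree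
    where
    module F = SolvesRecurrence F
    module G = SolvesRecurrence G
    agree : ∀ K → (∀ {K′} → K′ < K → ∀ n → f n K′ ≡ g n K′) → ∀ n → f n K ≡ g n K
    agree zero    _  n = trans (F.initial n) (sym (G.initial n))
    agree (suc K) IH n = begin
      f n (suc K)
        ≡⟨ F.step n K ⟩
      emptyTerm n (suc K) +ℤ ∑[ a < suc K ] (firstPartWeight a *ℤ f (n + suc r + r * a) (K ∸ a))
        ≡⟨ cong (emptyTerm n (suc K) +ℤ_) (∑-cong (suc K) (λ {a} _ →
             cong (firstPartWeight a *ℤ_) (IH (s≤s (ℕ.m∸n≤m K a)) (n + suc r + r * a)))) ⟩
      emptyTerm n (suc K) +ℤ ∑[ a < suc K ] (firstPartWeight a *ℤ g (n + suc r + r * a) (K ∸ a))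
        ≡⟨ sym (G.step n K) ⟩
      g n (suc K) ∎
      where open ≡-Reasoning

  lhs : ℕ → ℕ → ℤ
  lhs n K = ∑[ i < suc K ] + ((suc r * i + n) C i)

  lhs-pascal : ∀ n K → lhs n (suc K) +ℤ lhs (n + suc r) K ≡ lhs (suc n) (suc K)
  lhs-pascal n K = begin
    (+ 1 +ℤ ∑[ i < suc K ] f (suc i)) +ℤ ∑[ i < suc K ] g i
      ≡⟨ ℤ.+-assoc (+ 1) (∑[ i < suc K ] f (suc i)) (∑[ i < suc K ] g i) ⟩
    + 1 +ℤ (∑[ i < suc K ] f (suc i) +ℤ ∑[ i < suc K ] g i)
      ≡⟨ cong (+ 1 +ℤ_) (sym (∑-distrib-+ (suc K) (f ∘ suc) g)) ⟩
    + 1 +ℤ ∑[ i < suc K ] (f (suc i) +ℤ g i)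
      ≡⟨ cong (+ 1 +ℤ_) (∑-cong (suc K) (λ {i} _ → pascal-step i)) ⟩
    + 1 +ℤ ∑[ i < suc K ] + ((suc r * suc i + suc n) C suc i) ∎
    where
    open ≡-Reasoning
    f g : ℕ → ℤ
    f i = + ((suc r * i + n) C i)
    g i = + ((suc r * i + (n + suc r)) C i)
    pascal-step : ∀ i → f (suc i) +ℤ g i ≡ + ((suc r * suc i + suc n) C suc i)
    pascal-step i = begin
      + (x C suc i) +ℤ + ((suc r * i + (n + suc r)) C i)
        ≡⟨ cong (λ m → + (x C suc i) +ℤ + (m C i)) (x′≡x r i n) ⟩
      + (x C suc i) +ℤ + (x C i)
        ≡⟨ sym (ℤ.pos-+ (x C suc i) (x C i)) ⟩
      + (x C suc i + x C i)
        ≡⟨ cong +_ (trans (ℕ.+-comm (x C suc i) _) (sym (pascal x i))) ⟩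
      + (suc x C suc i)
        ≡⟨ cong (λ m → + (m C suc i)) (sym (ℕ.+-suc (suc r * suc i) n)) ⟩
      + ((suc r * suc i + suc n) C suc i) ∎
      where
      x : ℕ
      x = suc r * suc i + n
      x′≡x : ∀ r i n → suc r * i + (n + suc r) ≡ suc r * suc i + n
      x′≡x = NatSolver.solve-∀

  lhs-convolution : ∀ n K →
    ∑[ j < suc K ] (signedBinom r j *ℤ lhs (n + suc r + r * j) (K ∸ j)) ≡ lhs (suc n) K
  lhs-convolution n K = begin
    ∑[ j < suc K ] (signedBinom r j *ℤ lhs (n + suc r + r * j) (K ∸ j))
      ≡⟨ ∑-cong (suc K) (λ {j} _ → sym (∑-distribˡ-* (suc (K ∸ j)) (signedBinom r j) (T j))) ⟩
    ∑[ j < suc K ] ∑[ i < suc (K ∸ j) ] (signedBinom r j *ℤ T j i)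
      ≡⟨ sym (∑-triangle K (λ j i → signedBinom r j *ℤ T j i)) ⟩
    ∑[ b < suc K ] ∑[ j < suc b ] (signedBinom r j *ℤ T j (b ∸ j))
      ≡⟨ ∑-cong (suc K) (λ {b} _ → ∑-cong (suc b) (λ {j} j<1+b →
           cong (signedBinom r j *ℤ_) (T-diagonal (ℕ.≤-pred j<1+b)))) ⟩
    ∑[ b < suc K ] ∑[ j < suc b ] (signedBinom r j *ℤ + ((suc r * b + suc n + r ∸ j) C (b ∸ j)))
      ≡⟨ ∑-cong (suc K) (λ {b} _ → signedBinom-convolution r (suc r * b + suc n) b) ⟩
    lhs (suc n) K ∎
    where
    open ≡-Reasoning
    T : ℕ → ℕ → ℤ
    T j i = + ((suc r * i + (n + suc r + r * j)) C i)
    T-diagonal : ∀ {j b} → j ≤ b → T j (b ∸ j) ≡ + ((suc r * b + suc n + r ∸ j) C (b ∸ j))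
    T-diagonal {j} j≤b with d , refl ← ℕ.m≤n⇒∃[o]m+o≡n j≤b =
      cong (λ m → + (m C (j + d ∸ j))) (begin
        suc r * (j + d ∸ j) + (n + suc r + r * j)
          ≡⟨ cong (λ e → suc r * e + (n + suc r + r * j)) (ℕ.m+n∸m≡n j d) ⟩
        suc r * d + (n + suc r + r * j)
          ≡⟨ sym (m≡n+o⇒m∸n≡o j (split r j d n)) ⟩
        suc r * (j + d) + suc n + r ∸ j ∎)
      where
      split : ∀ r j d n → suc r * (j + d) + suc n + r ≡ j + (suc r * d + (n + suc r + r * j))
      split = NatSolver.solve-∀

  lhs-solves : SolvesRecurrence lhs
  lhs-solves = record { initial = λ _ → refl ; step = lhs-step }
    where
    lhs-step : ∀ n K → lhs n (suc K) ≡
               emptyTerm n (suc K) +ℤ ∑[ a < suc K ] (firstPartWeight a *ℤ lhs (n + suc r + r * a) (K ∸ a))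
    lhs-step n K = +ℤ-cancelʳ L (lhs n (suc K)) (E +ℤ T) (begin
      lhs n (suc K) +ℤ L    ≡⟨ lhs-pascal n K ⟩
      lhs (suc n) (suc K)   ≡⟨ ∑-init-last (suc K) (λ i → + ((suc r * i + suc n) C i)) ⟩
      lhs (suc n) K +ℤ E    ≡⟨ cong (_+ℤ E) peel ⟩
      L +ℤ T +ℤ E           ≡⟨ rotate L T E ⟩
      E +ℤ T +ℤ L           ∎)
      where
      open ≡-Reasoning
      L E T rest : ℤ
      L = lhs (n + suc r) K
      E = emptyTerm n (suc K)
      X : ℕ → ℤ
      X a = lhs (n + suc r + r * a) (K ∸ a)
      T = ∑[ a < suc K ] (firstPartWeight a *ℤ X a)
      rest = ∑[ a < K ] (signedBinom r (suc a) *ℤ X (suc a))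
      X0≡L : X 0 ≡ L
      X0≡L = cong (λ m → lhs m K) (trans (cong (λ m → n + suc r + m) (ℕ.*-zeroʳ r)) (ℕ.+-identityʳ _))
      peel : lhs (suc n) K ≡ L +ℤ T
      peel = begin
        lhs (suc n) K                   ≡⟨ sym (lhs-convolution n K) ⟩
        + 1 *ℤ X 0 +ℤ rest              ≡⟨ cong₂ _+ℤ_ (trans (ℤ.*-identityˡ (X 0)) X0≡L) (sym (ℤ.+-identityˡ rest)) ⟩
        L +ℤ (+ 0 +ℤ rest)              ∎
      rotate : ∀ b t e → b +ℤ t +ℤ e ≡ e +ℤ t +ℤ b
      rotate = ℤ-Solver.solve-∀

  IsPart : ℕ → Set
  IsPart a = 2 ≤ a × a ≤ suc r

  isPart? : ∀ a → Dec (IsPart a)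
  isPart? a = (2 ≤? a) ×-dec (a ≤? suc r)

  length≤sum : ∀ {β} → All IsPart β → ℓ β ≤ ∣ β ∣ᶜ
  length≤sum []                    = z≤n
  length≤sum ((2≤a , _) ∷ β-parts) = ℕ.+-mono-≤ (ℕ.≤-trans (s≤s z≤n) 2≤a) (length≤sum β-parts)

  rhs : ℕ → ℕ → ℤ
  rhs n K = sumℤ (map (rhsTerm K n r) (C-set K r))

  termIfValid : ℕ → ℕ → Composition → ℤ
  termIfValid K n α = if does (all? isPart? α) then rhsTerm K n r α else + 0

  termIfValid-valid : ∀ K n {α} → All IsPart α → termIfValid K n α ≡ rhsTerm K n r α
  termIfValid-valid K n {α} α-parts rewrite dec-true (all? isPart? α) α-parts = refl

  termIfValid-invalid : ∀ K n {α} → ¬ All IsPart α → termIfValid K n α ≡ + 0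
  termIfValid-invalid K n {α} ¬α-parts rewrite dec-false (all? isPart? α) ¬α-parts = refl

  rhs≡∑ᶜ≤ : ∀ n K → rhs n K ≡ ∑ᶜ≤ K (termIfValid K n)
  rhs≡∑ᶜ≤ n K = begin
    sumℤ (map (rhsTerm K n r) (filter (all? isPart?) (concatMap compositionsOf (upTo (suc K)))))
      ≡⟨ sumℤ-filter (all? isPart?) (rhsTerm K n r) (concatMap compositionsOf (upTo (suc K))) ⟩
    sumℤ (map (termIfValid K n) (concatMap compositionsOf (upTo (suc K))))
      ≡⟨ sumℤ-concatMap (termIfValid K n) compositionsOf (upTo (suc K)) ⟩
    sumℤ (map (λ m → ∑ᶜ m (termIfValid K n)) (upTo (suc K)))
      ≡⟨ sumℤ-map-applyUpTo (λ m → ∑ᶜ m (termIfValid K n)) (λ m → m) (suc K) ⟩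
    ∑ᶜ≤ K (termIfValid K n) ∎
    where open ≡-Reasoning

  rhsTerm-[] : ∀ K n → rhsTerm K n r [] ≡ emptyTerm n K
  rhsTerm-[] K n = trans (ℤ.*-identityˡ _) (cong +_ (trans (ℕ.+-identityʳ _)
    (cong (_C K) (trans (ℕ.+-identityʳ _) (top-index r K n)))))
    where
    top-index : ∀ r K n → suc r * K + n + 1 ≡ suc r * K + suc n
    top-index = NatSolver.solve-∀

  rhsTerm-top-index : ∀ K n a s l → a + s ≤ K →
    suc r * suc K + n + 1 ∸ suc (a + s) + suc l ≡ suc r * (K ∸ a) + (n + suc r + r * a) + 1 ∸ s + l
  rhsTerm-top-index K n a s l a+s≤K with d , refl ← ℕ.m≤n⇒∃[o]m+o≡n a+s≤K = begin
    suc r * suc (a + s + d) + n + 1 ∸ suc (a + s) + suc l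
      ≡⟨ cong (_+ suc l) (m≡n+o⇒m∸n≡o (suc (a + s)) (split₁ r a s d n)) ⟩
    t + suc l
      ≡⟨ ℕ.+-suc t l ⟩
    suc t + l
      ≡⟨ cong (_+ l) (sym (m≡n+o⇒m∸n≡o s (split₂ r a s d n))) ⟩
    suc r * (s + d) + (n + suc r + r * a) + 1 ∸ s + l
      ≡⟨ cong (λ e → suc r * e + (n + suc r + r * a) + 1 ∸ s + l) (sym a+s+d∸a≡s+d) ⟩
    suc r * (a + s + d ∸ a) + (n + suc r + r * a) + 1 ∸ s + l ∎
    where
    open ≡-Reasoning
    t : ℕ
    t = d + n + 1 + r * suc (a + s + d)
    split₁ : ∀ r a s d n → suc r * suc (a + s + d) + n + 1 ≡ suc (a + s) + (d + n + 1 + r * suc (a + s + d))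
    split₁ = NatSolver.solve-∀
    split₂ : ∀ r a s d n →
      suc r * (s + d) + (n + suc r + r * a) + 1 ≡ s + suc (d + n + 1 + r * suc (a + s + d))
    split₂ = NatSolver.solve-∀
    a+s+d∸a≡s+d : a + s + d ∸ a ≡ s + d
    a+s+d∸a≡s+d = trans (cong (_∸ a) (ℕ.+-assoc a s d)) (ℕ.m+n∸m≡n a (s + d))

  rhsTerm-∷ : ∀ K n a β → ℓ β ≤ ∣ β ∣ᶜ → a + ∣ β ∣ᶜ ≤ K →
    rhsTerm (suc K) n r (suc a ∷ β) ≡ signedBinom r a *ℤ rhsTerm (K ∸ a) (n + suc r + r * a) r β
  rhsTerm-∷ K n a β l≤s a+s≤K = begin
    sgn (a + s ∸ l) *ℤ + ((r C a) * P * B₁)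
      ≡⟨ cong₂ (λ e B → sgn e *ℤ + ((r C a) * P * B)) (ℕ.+-∸-assoc a l≤s)
               (cong₂ _C_ (rhsTerm-top-index K n a s l a+s≤K) (sym (ℕ.∸-+-assoc K a s))) ⟩
    sgn (a + (s ∸ l)) *ℤ + ((r C a) * P * B₂)
      ≡⟨ cong₂ _*ℤ_ (sgn-+ a (s ∸ l)) (trans (cong +_ (ℕ.*-assoc (r C a) P B₂)) (ℤ.pos-* (r C a) (P * B₂))) ⟩
    sgn a *ℤ sgn (s ∸ l) *ℤ (+ (r C a) *ℤ + (P * B₂))
      ≡⟨ *ℤ-interchange (sgn a) (sgn (s ∸ l)) (+ (r C a)) (+ (P * B₂)) ⟩
    signedBinom r a *ℤ rhsTerm (K ∸ a) (n + suc r + r * a) r β ∎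
    where
    open ≡-Reasoning
    s l P B₁ B₂ : ℕ
    s = ∣ β ∣ᶜ
    l = ℓ β
    P = product (map (λ p → r C (p ∸ 1)) β)
    B₁ = (suc r * suc K + n + 1 ∸ suc (a + s) + suc l) C (K ∸ (a + s))
    B₂ = (suc r * (K ∸ a) + (n + suc r + r * a) + 1 ∸ s + l) C (K ∸ a ∸ s)

  termIfValid-∷ : ∀ K n a β → a + ∣ β ∣ᶜ ≤ K →
    termIfValid (suc K) n (suc a ∷ β) ≡ firstPartWeight a *ℤ termIfValid (K ∸ a) (n + suc r + r * a) β
  termIfValid-∷ K n zero    β _     = refl
  termIfValid-∷ K n (suc j) β a+s≤K = by-cases (isPart? (suc (suc j))) (all? isPart? β)
    where
    n′ : ℕ
    n′ = n + suc r + r * suc j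
    by-cases : Dec (IsPart (suc (suc j))) → Dec (All IsPart β) →
      termIfValid (suc K) n (suc (suc j) ∷ β) ≡ signedBinom r (suc j) *ℤ termIfValid (K ∸ suc j) n′ β
    by-cases (no ¬part) _ = begin
      termIfValid (suc K) n (suc (suc j) ∷ β)
        ≡⟨ termIfValid-invalid (suc K) n {suc (suc j) ∷ β} (λ { (part ∷ _) → ¬part part }) ⟩
      + 0
        ≡⟨ cong (_*ℤ termIfValid (K ∸ suc j) n′ β) (sym (signedBinom-vanishes r<1+j)) ⟩
      signedBinom r (suc j) *ℤ termIfValid (K ∸ suc j) n′ β ∎
      where
      open ≡-Reasoning
      r<1+j : r < suc j
      r<1+j = ℕ.≰⇒> (λ 1+j≤r → ¬part (s≤s (s≤s z≤n) , s≤s 1+j≤r))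
    by-cases (yes _) (no ¬β-parts) = begin
      termIfValid (suc K) n (suc (suc j) ∷ β)
        ≡⟨ termIfValid-invalid (suc K) n {suc (suc j) ∷ β} (λ { (_ ∷ β-parts) → ¬β-parts β-parts }) ⟩
      + 0
        ≡⟨ sym (ℤ.*-zeroʳ (signedBinom r (suc j))) ⟩
      signedBinom r (suc j) *ℤ + 0
        ≡⟨ cong (signedBinom r (suc j) *ℤ_) (sym (termIfValid-invalid (K ∸ suc j) n′ ¬β-parts)) ⟩
      signedBinom r (suc j) *ℤ termIfValid (K ∸ suc j) n′ β ∎
      where open ≡-Reasoning
    by-cases (yes part) (yes β-parts) = begin
      termIfValid (suc K) n (suc (suc j) ∷ β)
        ≡⟨ termIfValid-valid (suc K) n (part ∷ β-parts) ⟩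
      rhsTerm (suc K) n r (suc (suc j) ∷ β)
        ≡⟨ rhsTerm-∷ K n (suc j) β (length≤sum β-parts) a+s≤K ⟩
      signedBinom r (suc j) *ℤ rhsTerm (K ∸ suc j) n′ r β
        ≡⟨ cong (signedBinom r (suc j) *ℤ_) (sym (termIfValid-valid (K ∸ suc j) n′ β-parts)) ⟩
      signedBinom r (suc j) *ℤ termIfValid (K ∸ suc j) n′ β ∎
      where open ≡-Reasoning

  rhs-solves : SolvesRecurrence rhs
  rhs-solves = record { initial = λ _ → refl ; step = rhs-step }
    where
    rhs-step : ∀ n K → rhs n (suc K) ≡
               emptyTerm n (suc K) +ℤ ∑[ a < suc K ] (firstPartWeight a *ℤ rhs (n + suc r + r * a) (K ∸ a))
    rhs-step n K = begin
      rhs n (suc K)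
        ≡⟨ rhs≡∑ᶜ≤ n (suc K) ⟩
      ∑ᶜ≤ (suc K) (termIfValid (suc K) n)
        ≡⟨ ∑ᶜ≤-suc K (termIfValid (suc K) n) ⟩
      termIfValid (suc K) n [] +ℤ ∑[ a < suc K ] ∑ᶜ≤ (K ∸ a) (λ β → termIfValid (suc K) n (suc a ∷ β))
        ≡⟨ cong₂ _+ℤ_ (rhsTerm-[] (suc K) n) (∑-cong (suc K) (λ a<1+K → tail-sum (ℕ.≤-pred a<1+K))) ⟩
      emptyTerm n (suc K) +ℤ ∑[ a < suc K ] (firstPartWeight a *ℤ rhs (n + suc r + r * a) (K ∸ a)) ∎
      where
      open ≡-Reasoning
      tail-sum : ∀ {a} → a ≤ K → ∑ᶜ≤ (K ∸ a) (λ β → termIfValid (suc K) n (suc a ∷ β)) ≡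
                                 firstPartWeight a *ℤ rhs (n + suc r + r * a) (K ∸ a)
      tail-sum {a} a≤K = begin
        ∑ᶜ≤ (K ∸ a) (λ β → termIfValid (suc K) n (suc a ∷ β))
          ≡⟨ ∑ᶜ≤-cong (K ∸ a) (λ β ∣β∣≤K∸a → termIfValid-∷ K n a β
               (ℕ.≤-trans (ℕ.≤-reflexive (ℕ.+-comm a _)) (ℕ.m≤o∸n⇒m+n≤o _ a≤K ∣β∣≤K∸a))) ⟩
        ∑ᶜ≤ (K ∸ a) (λ β → firstPartWeight a *ℤ termIfValid (K ∸ a) n′ β)
          ≡⟨ ∑ᶜ≤-distribˡ-* (K ∸ a) (firstPartWeight a) (termIfValid (K ∸ a) n′) ⟩
        firstPartWeight a *ℤ ∑ᶜ≤ (K ∸ a) (termIfValid (K ∸ a) n′)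
          ≡⟨ cong (firstPartWeight a *ℤ_) (sym (rhs≡∑ᶜ≤ n′ (K ∸ a))) ⟩
        firstPartWeight a *ℤ rhs n′ (K ∸ a) ∎
        where
        n′ : ℕ
        n′ = n + suc r + r * a

corollary3p2 : ∀ (k n r : ℕ) →
    + (Σ≤ k (λ i → ((suc r) * i + n) C i)) ≡ sumℤ (map (rhsTerm k n r) (C-set k r))
corollary3p2 k n r = begin
  + sum (map binom (upTo (suc k)))           ≡⟨ pos-sum-map binom (upTo (suc k)) ⟩
  sumℤ (map (+_ ∘ binom) (upTo (suc k)))     ≡⟨ sumℤ-map-applyUpTo (+_ ∘ binom) (λ i → i) (suc k) ⟩
  lhs r n k                                  ≡⟨ recurrence-unique r (lhs-solves r) (rhs-solves r) k n ⟩
  rhs r n k                                  ∎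
  where
  open ≡-Reasoning
  binom : ℕ → ℕ
  binom i = (suc r * i + n) C i
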